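{- Let $G=([d],E)$ be a finite simple graph and $\lambda=(\lambda_1,\dots,\lambda_d)\in\mathbb{Z}_{>0}^d$. Then there exist graphs $H_1,\dots,H_\ell$, each on $\lambda_1+\cdots+\lambda_d$ vertices, and integers $k_1,\dots,k_\ell$ such that for all positive integers $n$, \[ \chi_G^\lambda(q,n) \;=\; \sum_{i=1}^\ell k_i\, \chi^{\mathbf 1}_{H_i}(q,n). \]
   Context: For a graph $H$ and a vector $\mu$ of positive integer vertex weights, $\chi_H^\mu(q,n):=\sum_c q^{\sum_{v}\mu_v c(v)}$, summed over proper colorings $c$ of $H$ with colors in $\{1,\dots,n\}$ ($c(u)\neq c(w)$ for every edge $uw$); $\mathbf 1$ denotes the all-ones weight vector. -}

module Defs where

open import Data.Bool using (Bool; true; false; if_then_else_; _∧_; _∨_; not)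
open import Data.Nat as ℕ using (ℕ; zero; suc)
open import Data.Fin using (Fin; zero; suc; toℕ; _≟_)
open import Data.List using (List; []; _∷_; map; concatMap; foldr; allFin)
open import Data.Integer as ℤ using (ℤ)
open import Relation.Binary.PropositionalEquality using (_≡_)
open import Relation.Nullary.Decidable using (⌊_⌋)

record SimpleGraph (d : ℕ) : Set where
  field
    adj    : Fin d → Fin d → Bool
    sym    : ∀ u w → adj u w ≡ adj w u
    irrefl : ∀ u → adj u u ≡ false
open SimpleGraph public

consF : ∀ {d n} → Fin n → (Fin d → Fin n) → Fin (suc d) → Fin n
consF i c zero    = i
consF i c (suc j) = c j

allMaps : (d n : ℕ) → List (Fin d → Fin n)
allMaps zero    n = (λ ()) ∷ []
allMaps (suc d) n = concatMap (λ c → map (λ i → consF i c) (allFin n)) (allMaps d n)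

allᵇ : ∀ {A : Set} → (A → Bool) → List A → Bool
allᵇ p = foldr (λ x b → p x ∧ b) true

isProper : ∀ {d n} → SimpleGraph d → (Fin d → Fin n) → Bool
isProper {d} G c =
  allᵇ (λ u → allᵇ (λ w → not (adj G u w) ∨ not ⌊ c u ≟ c w ⌋) (allFin d)) (allFin d)

sumℕ : ∀ {d} → (Fin d → ℕ) → ℕ
sumℕ {d} f = foldr ℕ._+_ 0 (map f (allFin d))

sumℤ : ∀ {ℓ} → (Fin ℓ → ℤ) → ℤ
sumℤ {ℓ} f = foldr ℤ._+_ (ℤ.+ 0) (map f (allFin ℓ))

-- colors are {1,…,n}; the Fin n value i stands for the color toℕ i + 1
weight : ∀ {d n} → (Fin d → ℕ) → (Fin d → Fin n) → ℕ
weight μ c = sumℕ (λ v → μ v ℕ.* suc (toℕ (c v)))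

chi : ∀ {d} → SimpleGraph d → (Fin d → ℕ) → ℤ → ℕ → ℤ
chi {d} G μ q n =
  foldr (λ c acc → if isProper G c then q ℤ.^ weight μ c ℤ.+ acc else acc)
        (ℤ.+ 0) (allMaps d n)

𝟏 : ∀ {d} → Fin d → ℕ
𝟏 _ = 1

{-# OPTIONS --safe #-}
-- Move one unit of weight from a vertex v with λ_v ≥ 2 to a new vertex 0, giving weights
-- μ = (1, λ − e_v) of the same total. Among the colourings of G plus an isolated vertex 0,
-- those giving 0 the colour of v have exactly the weights of the λ-colourings of G, and the
-- others are the proper colourings of G plus the edge 0v. Hence χ_G^λ = χ_{G+0}^μ − χ_{G+0v}^μ;
-- the excess Σ(λ_i − 1) drops by one, and iterating ends at graphs on Σλ vertices with unit weights.
module Submission where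

open import Defs
open import Data.Nat using (ℕ; _≤_)
open import Data.Fin using (Fin)
open import Data.Integer using (ℤ; _*_)
open import Data.Product using (Σ; ∃; _,_)
open import Relation.Binary.PropositionalEquality using (_≡_)

open import Algebra.Bundles using (CommutativeMonoid)
open import Data.Bool using (Bool; true; false; if_then_else_; _∧_; _∨_; not)
open import Data.Bool.Properties using (∧-commutativeMonoid; ∧-assoc; ∧-idem)
open import Data.Empty using (⊥-elim)
open import Data.Fin using (zero; suc; toℕ; _≟_; punchIn)
open import Data.Fin.Properties using (any?; punchInᵢ≢i)
open import Data.Integer using (_+_; _-_; -_; _^_; 0ℤ; 1ℤ)
import Data.Integer.Properties as ℤₚ
open import Data.List using (List; []; _∷_; _++_; map; concatMap; foldr; tabulate; lookup; length; allFin)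
open import Data.List.Properties using (map-tabulate; map-cong; tabulate-lookup)
open import Data.Nat as ℕ using (zero; suc; pred; _≤?_; s≤s; z≤n)
import Data.Nat.Properties as ℕₚ
open import Data.Product using (_×_; proj₁; proj₂; map₁)
import Data.Vec.Functional as Vector
open import Data.Vec.Functional using (Vector; updateAt; removeAt; replicate)
open import Data.Vec.Functional.Properties using (updateAt-updates; updateAt-minimal)
open import Function using (_∘_; id; const)
open import Relation.Binary.PropositionalEquality as ≡
  using (refl; trans; cong; cong₂; subst; _≢_; _≗_; module ≡-Reasoning)
open import Relation.Nullary using (yes; no)
open import Relation.Nullary.Decidable using (⌊_⌋; isYes≗does; dec-true; dec-false)

open import Algebra.Properties.AbelianGroup ℤₚ.+-0-abelianGroup using (x≈z//y)

foldr-tabulate : ∀ {a b c} {A : Set a} {B : Set b} {C : Set c}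
                 (_∙_ : B → C → C) (e : C) (f : A → B) {n} (h : Fin n → A) →
                 foldr (λ x y → f x ∙ y) e (tabulate h) ≡ Vector.foldr _∙_ e (f ∘ h)
foldr-tabulate _∙_ e f {zero}  h = refl
foldr-tabulate _∙_ e f {suc n} h = cong (f (h zero) ∙_) (foldr-tabulate _∙_ e f (h ∘ suc))

module FiniteSums {c ℓ} (M : CommutativeMonoid c ℓ) where

  open CommutativeMonoid M
    using (Carrier; _≈_; _∙_; ε; setoid; ∙-cong; ∙-congˡ; assoc; identityˡ; identityʳ; commutativeSemigroup)
    renaming (refl to ≈-refl; sym to ≈-sym; trans to ≈-trans)
  open import Algebra.Properties.CommutativeMonoid.Sum M public
  open import Algebra.Properties.CommutativeSemigroup commutativeSemigroup using (interchange)
  open import Relation.Binary.Reasoning.Setoid setoid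

  sum-cong-except : ∀ {n} {f g : Vector Carrier n} {x} (v : Fin n) →
                    (∀ j → j ≢ v → f j ≈ g j) → x ∙ f v ≈ g v → x ∙ sum f ≈ sum g
  sum-cong-except {suc n} {f} {g} {x} v off at = begin
    x ∙ sum f                          ≈⟨ ∙-congˡ (sum-remove {i = v} f) ⟩
    x ∙ (f v ∙ sum (removeAt f v))     ≈⟨ assoc x (f v) _ ⟨
    (x ∙ f v) ∙ sum (removeAt f v)     ≈⟨ ∙-cong at (sum-cong-≋ (λ j → off (punchIn v j) (punchInᵢ≢i v j))) ⟩
    g v ∙ sum (removeAt g v)           ≈⟨ sum-remove {i = v} g ⟨
    sum g                              ∎

  sum-single : ∀ {n} {f : Vector Carrier n} (v : Fin n) → (∀ j → j ≢ v → f j ≈ ε) → sum f ≈ f v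
  sum-single {n} {f} v off = begin
    sum f                      ≈⟨ sum-cong-except v (λ j j≢v → ≈-sym (off j j≢v)) (identityʳ (f v)) ⟨
    f v ∙ sum (replicate n ε)  ≈⟨ ∙-congˡ (sum-replicate-zero n) ⟩
    f v ∙ ε                    ≈⟨ identityʳ (f v) ⟩
    f v                        ∎

  ∑ˡ : ∀ {a} {A : Set a} → (A → Carrier) → List A → Carrier
  ∑ˡ f = foldr (λ x s → f x ∙ s) ε

  ∑ˡ-cong : ∀ {a} {A : Set a} {f g : A → Carrier} → (∀ x → f x ≈ g x) →
            ∀ xs → ∑ˡ f xs ≈ ∑ˡ g xs
  ∑ˡ-cong f≈g []       = ≈-refl
  ∑ˡ-cong f≈g (x ∷ xs) = ∙-cong (f≈g x) (∑ˡ-cong f≈g xs)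

  ∑ˡ-++ : ∀ {a} {A : Set a} (f : A → Carrier) xs ys → ∑ˡ f (xs ++ ys) ≈ ∑ˡ f xs ∙ ∑ˡ f ys
  ∑ˡ-++ f []       ys = ≈-sym (identityˡ _)
  ∑ˡ-++ f (x ∷ xs) ys = ≈-trans (∙-congˡ (∑ˡ-++ f xs ys)) (≈-sym (assoc _ _ _))

  ∑ˡ-distrib : ∀ {a} {A : Set a} (f g : A → Carrier) xs →
               ∑ˡ (λ x → f x ∙ g x) xs ≈ ∑ˡ f xs ∙ ∑ˡ g xs
  ∑ˡ-distrib f g []       = ≈-sym (identityˡ ε)
  ∑ˡ-distrib f g (x ∷ xs) =
    ≈-trans (∙-congˡ (∑ˡ-distrib f g xs)) (interchange (f x) (g x) (∑ˡ f xs) (∑ˡ g xs))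

  ∑ˡ-concatMap : ∀ {a b} {A : Set a} {B : Set b} (f : B → Carrier) (g : A → List B) xs →
                 ∑ˡ f (concatMap g xs) ≈ ∑ˡ (∑ˡ f ∘ g) xs
  ∑ˡ-concatMap f g []       = ≈-refl
  ∑ˡ-concatMap f g (x ∷ xs) = ≈-trans (∑ˡ-++ f (g x) (concatMap g xs)) (∙-congˡ (∑ˡ-concatMap f g xs))

  ∑ˡ-tabulate : ∀ {a} {A : Set a} (f : A → Carrier) {n} (h : Fin n → A) →
                ∑ˡ f (tabulate h) ≡ sum (f ∘ h)
  ∑ˡ-tabulate = foldr-tabulate _∙_ ε

module ℕΣ = FiniteSums ℕₚ.+-0-commutativeMonoid
module 𝔹Σ = FiniteSums ∧-commutativeMonoid
open FiniteSums ℤₚ.+-0-commutativeMonoid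
  using (sum; sum-syntax; sum-cong-≗; sum-cong-except
        ; ∑ˡ; ∑ˡ-cong; ∑ˡ-++; ∑ˡ-distrib; ∑ˡ-concatMap; ∑ˡ-tabulate)

⋀ : ∀ {n} → (Fin n → Bool) → Bool
⋀ = 𝔹Σ.sum

⌊≟⌋-refl : ∀ {n} (i : Fin n) → ⌊ i ≟ i ⌋ ≡ true
⌊≟⌋-refl i = trans (isYes≗does (i ≟ i)) (dec-true (i ≟ i) refl)

⌊≟⌋-≢ : ∀ {n} {i j : Fin n} → i ≢ j → ⌊ i ≟ j ⌋ ≡ false
⌊≟⌋-≢ {i = i} {j} i≢j = trans (isYes≗does (i ≟ j)) (dec-false (i ≟ j) i≢j)

⌊≟⌋-sym : ∀ {n} (i j : Fin n) → ⌊ i ≟ j ⌋ ≡ ⌊ j ≟ i ⌋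
⌊≟⌋-sym i j with i ≟ j
... | yes refl = ≡.sym (⌊≟⌋-refl i)
... | no i≢j   = ≡.sym (⌊≟⌋-≢ (i≢j ∘ ≡.sym))

sumℕ≡sum : ∀ {d} (f : Fin d → ℕ) → sumℕ f ≡ ℕΣ.sum f
sumℕ≡sum f = trans (cong (foldr ℕ._+_ 0) (map-tabulate id f)) (ℕΣ.∑ˡ-tabulate id f)

sumℤ≡sum : ∀ {ℓ} (f : Fin ℓ → ℤ) → sumℤ f ≡ sum f
sumℤ≡sum f = trans (cong (foldr _+_ 0ℤ) (map-tabulate id f)) (∑ˡ-tabulate id f)

weight≡sum : ∀ {d n} (μ : Fin d → ℕ) (c : Fin d → Fin n) →
             weight μ c ≡ ℕΣ.sum (λ j → μ j ℕ.* suc (toℕ (c j)))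
weight≡sum μ c = sumℕ≡sum (λ j → μ j ℕ.* suc (toℕ (c j)))

isProper≡⋀ : ∀ {d n} (G : SimpleGraph d) (c : Fin d → Fin n) →
             isProper G c ≡ ⋀ λ u → ⋀ λ w → not (adj G u w) ∨ not ⌊ c u ≟ c w ⌋
isProper≡⋀ G c =
  trans (𝔹Σ.∑ˡ-tabulate row id) (𝔹Σ.sum-cong-≗ (λ u → 𝔹Σ.∑ˡ-tabulate (entry u) id))
  where
  entry : Fin _ → Fin _ → Bool
  entry u w = not (adj G u w) ∨ not ⌊ c u ≟ c w ⌋
  row : Fin _ → Bool
  row u = allᵇ (entry u) (allFin _)

addVertex : ∀ {d} → SimpleGraph d → (Fin d → Bool) → SimpleGraph (suc d)
addVertex {d} G N = record { adj = adj′ ; sym = sym′ ; irrefl = irrefl′ }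
  where
  adj′ : Fin (suc d) → Fin (suc d) → Bool
  adj′ zero    zero    = false
  adj′ zero    (suc w) = N w
  adj′ (suc u) zero    = N u
  adj′ (suc u) (suc w) = adj G u w

  sym′ : ∀ u w → adj′ u w ≡ adj′ w u
  sym′ zero    zero    = refl
  sym′ zero    (suc w) = refl
  sym′ (suc u) zero    = refl
  sym′ (suc u) (suc w) = SimpleGraph.sym G u w

  irrefl′ : ∀ u → adj′ u u ≡ false
  irrefl′ zero    = refl
  irrefl′ (suc u) = irrefl G u

addIsolatedVertex : ∀ {d} → SimpleGraph d → SimpleGraph (suc d)
addIsolatedVertex G = addVertex G (const false)

addPendantVertex : ∀ {d} → SimpleGraph d → Fin d → SimpleGraph (suc d)
addPendantVertex G v = addVertex G (λ u → ⌊ u ≟ v ⌋)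

avoids : ∀ {d n} → (Fin d → Bool) → (Fin d → Fin n) → Fin n → Bool
avoids N c i = ⋀ λ u → not (N u) ∨ not ⌊ c u ≟ i ⌋

isProper-addVertex : ∀ {d n} (G : SimpleGraph d) (N : Fin d → Bool) (i : Fin n) (c : Fin d → Fin n) →
                     isProper (addVertex G N) (consF i c) ≡ avoids N c i ∧ isProper G c
isProper-addVertex G N i c = begin
  isProper (addVertex G N) (consF i c)
    ≡⟨ isProper≡⋀ (addVertex G N) (consF i c) ⟩
  ⋀ (λ w → not (N w) ∨ not ⌊ i ≟ c w ⌋) ∧ ⋀ (λ u → (not (N u) ∨ not ⌊ c u ≟ i ⌋) ∧ row u)
    ≡⟨ cong₂ _∧_ (𝔹Σ.sum-cong-≗ (λ w → cong (λ b → not (N w) ∨ not b) (⌊≟⌋-sym i (c w))))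
                 (𝔹Σ.∑-distrib-+ (λ u → not (N u) ∨ not ⌊ c u ≟ i ⌋) row) ⟩
  avoids N c i ∧ (avoids N c i ∧ ⋀ row)
    ≡⟨ ∧-assoc (avoids N c i) _ _ ⟨
  (avoids N c i ∧ avoids N c i) ∧ ⋀ row
    ≡⟨ cong₂ _∧_ (∧-idem (avoids N c i)) (≡.sym (isProper≡⋀ G c)) ⟩
  avoids N c i ∧ isProper G c ∎
  where
  open ≡-Reasoning
  row : Fin _ → Bool
  row u = ⋀ λ w → not (adj G u w) ∨ not ⌊ c u ≟ c w ⌋

avoids-nothing : ∀ {d n} (c : Fin d → Fin n) i → avoids (const false) c i ≡ true
avoids-nothing {d} c i = 𝔹Σ.sum-replicate-zero d

avoids-single : ∀ {d n} (v : Fin d) (c : Fin d → Fin n) i →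
                avoids (λ u → ⌊ u ≟ v ⌋) c i ≡ not ⌊ c v ≟ i ⌋
avoids-single v c i =
  trans (𝔹Σ.sum-single v off) (cong (λ b → not b ∨ not ⌊ c v ≟ i ⌋) (⌊≟⌋-refl v))
  where
  off : ∀ u → u ≢ v → not ⌊ u ≟ v ⌋ ∨ not ⌊ c u ≟ i ⌋ ≡ true
  off u u≢v = cong (λ b → not b ∨ not ⌊ c u ≟ i ⌋) (⌊≟⌋-≢ u≢v)

infixr 7 [_]·_
[_]·_ : Bool → ℤ → ℤ
[ b ]· x = if b then x else 0ℤ

∑-[]·-split : ∀ {n} (b : Bool) (X : Fin n → ℤ) (j : Fin n) →
              ∑[ i < n ] ([ b ]· X i) ≡ [ b ]· X j + ∑[ i < n ] ([ not ⌊ j ≟ i ⌋ ∧ b ]· X i)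
∑-[]·-split b X j = ≡.sym (sum-cong-except {x = [ b ]· X j} j off at)
  where
  off : ∀ i → i ≢ j → [ not ⌊ j ≟ i ⌋ ∧ b ]· X i ≡ [ b ]· X i
  off i i≢j = cong (λ t → [ not t ∧ b ]· X i) (⌊≟⌋-≢ (i≢j ∘ ≡.sym))
  at : [ b ]· X j + [ not ⌊ j ≟ j ⌋ ∧ b ]· X j ≡ [ b ]· X j
  at = trans (cong (λ t → [ b ]· X j + [ not t ∧ b ]· X j) (⌊≟⌋-refl j)) (ℤₚ.+-identityʳ _)

chi≡∑ˡ : ∀ {d} (G : SimpleGraph d) (μ : Fin d → ℕ) q n →
         chi G μ q n ≡ ∑ˡ (λ c → [ isProper G c ]· q ^ weight μ c) (allMaps d n)
chi≡∑ˡ {d} G μ q n = go (allMaps d n)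
  where
  go : ∀ cs → foldr (λ c s → if isProper G c then q ^ weight μ c + s else s) 0ℤ cs
            ≡ ∑ˡ (λ c → [ isProper G c ]· q ^ weight μ c) cs
  go []       = refl
  go (c ∷ cs) with isProper G c
  ... | true  = cong (q ^ weight μ c +_) (go cs)
  ... | false = trans (go cs) (≡.sym (ℤₚ.+-identityˡ _))

chi-cong : ∀ {d} (G : SimpleGraph d) {μ ν : Fin d → ℕ} → μ ≗ ν →
           ∀ q n → chi G μ q n ≡ chi G ν q n
chi-cong {d} G {μ} {ν} μ≗ν q n = begin
  chi G μ q n                                                ≡⟨ chi≡∑ˡ G μ q n ⟩
  ∑ˡ (λ c → [ isProper G c ]· q ^ weight μ c) (allMaps d n)  ≡⟨ ∑ˡ-cong same-weight (allMaps d n) ⟩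
  ∑ˡ (λ c → [ isProper G c ]· q ^ weight ν c) (allMaps d n)  ≡⟨ chi≡∑ˡ G ν q n ⟨
  chi G ν q n                                                ∎
  where
  open ≡-Reasoning
  same-weight : ∀ c → [ isProper G c ]· q ^ weight μ c ≡ [ isProper G c ]· q ^ weight ν c
  same-weight c = cong (λ w → [ isProper G c ]· q ^ w) (cong (foldr ℕ._+_ 0) (map-cong μs≗νs (allFin d)))
    where
    μs≗νs : ∀ j → μ j ℕ.* suc (toℕ (c j)) ≡ ν j ℕ.* suc (toℕ (c j))
    μs≗νs j = cong (ℕ._* suc (toℕ (c j))) (μ≗ν j)

chi-addVertex : ∀ {d} (G : SimpleGraph d) (N : Fin d → Bool) (μ : Fin (suc d) → ℕ) q n
                (B : (Fin d → Fin n) → Fin n → Bool) → (∀ c i → avoids N c i ≡ B c i) →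
                chi (addVertex G N) μ q n
                ≡ ∑ˡ (λ c → ∑[ i < n ] ([ B c i ∧ isProper G c ]· q ^ weight μ (consF i c)))
                     (allMaps d n)
chi-addVertex {d} G N μ q n B avoids≡B = begin
  chi (addVertex G N) μ q n
    ≡⟨ chi≡∑ˡ (addVertex G N) μ q n ⟩
  ∑ˡ F (concatMap (λ c → map (λ i → consF i c) (allFin n)) (allMaps d n))
    ≡⟨ ∑ˡ-concatMap F (λ c → map (λ i → consF i c) (allFin n)) (allMaps d n) ⟩
  ∑ˡ (λ c → ∑ˡ F (map (λ i → consF i c) (allFin n))) (allMaps d n)
    ≡⟨ ∑ˡ-cong extend (allMaps d n) ⟩
  ∑ˡ (λ c → ∑[ i < n ] ([ B c i ∧ isProper G c ]· q ^ weight μ (consF i c))) (allMaps d n) ∎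
  where
  open ≡-Reasoning
  F : (Fin (suc d) → Fin n) → ℤ
  F c′ = [ isProper (addVertex G N) c′ ]· q ^ weight μ c′
  extend : ∀ c → ∑ˡ F (map (λ i → consF i c) (allFin n))
                 ≡ ∑[ i < n ] ([ B c i ∧ isProper G c ]· q ^ weight μ (consF i c))
  extend c = begin
    ∑ˡ F (map (λ i → consF i c) (allFin n))
      ≡⟨ cong (∑ˡ F) (map-tabulate id (λ i → consF i c)) ⟩
    ∑ˡ F (tabulate (λ i → consF i c))
      ≡⟨ ∑ˡ-tabulate F (λ i → consF i c) ⟩
    ∑[ i < n ] F (consF i c)
      ≡⟨ sum-cong-≗ (λ i → cong (λ b → [ b ]· q ^ weight μ (consF i c)) (isProper≡B i)) ⟩
    ∑[ i < n ] ([ B c i ∧ isProper G c ]· q ^ weight μ (consF i c)) ∎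
    where
    isProper≡B : ∀ i → isProper (addVertex G N) (consF i c) ≡ B c i ∧ isProper G c
    isProper≡B i = trans (isProper-addVertex G N i c) (cong (_∧ isProper G c) (avoids≡B c i))

splitWeight : ∀ {d} → (Fin d → ℕ) → Fin d → Fin (suc d) → ℕ
splitWeight λ′ v = 1 Vector.∷ updateAt λ′ v pred

module _ {d} (λ′ : Fin d → ℕ) (v : Fin d) where

  1+pred-updateAt : 1 ≤ λ′ v → 1 ℕ.+ updateAt λ′ v pred v ≡ λ′ v
  1+pred-updateAt 1≤λv =
    trans (cong suc (updateAt-updates v λ′)) (ℕₚ.suc-pred (λ′ v) {{ℕ.>-nonZero 1≤λv}})

  sum-splitWeight : 1 ≤ λ′ v → ℕΣ.sum (splitWeight λ′ v) ≡ ℕΣ.sum λ′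
  sum-splitWeight 1≤λv =
    ℕΣ.sum-cong-except v (λ j j≢v → updateAt-minimal j v λ′ j≢v) (1+pred-updateAt 1≤λv)

  weight-splitWeight : ∀ {n} → 1 ≤ λ′ v → (c : Fin d → Fin n) →
                       weight (splitWeight λ′ v) (consF (c v) c) ≡ weight λ′ c
  weight-splitWeight 1≤λv c = begin
    weight (splitWeight λ′ v) (consF (c v) c)
      ≡⟨ weight≡sum (splitWeight λ′ v) (consF (c v) c) ⟩
    1 ℕ.* s v ℕ.+ ℕΣ.sum (λ j → updateAt λ′ v pred j ℕ.* s j)
      ≡⟨ ℕΣ.sum-cong-except v off at ⟩
    ℕΣ.sum (λ j → λ′ j ℕ.* s j)
      ≡⟨ weight≡sum λ′ c ⟨
    weight λ′ c ∎
    where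
    open ≡-Reasoning
    s : Fin d → ℕ
    s j = suc (toℕ (c j))
    off : ∀ j → j ≢ v → updateAt λ′ v pred j ℕ.* s j ≡ λ′ j ℕ.* s j
    off j j≢v = cong (ℕ._* s j) (updateAt-minimal j v λ′ j≢v)
    at : 1 ℕ.* s v ℕ.+ updateAt λ′ v pred v ℕ.* s v ≡ λ′ v ℕ.* s v
    at = trans (≡.sym (ℕₚ.*-distribʳ-+ (s v) 1 (updateAt λ′ v pred v)))
               (cong (ℕ._* s v) (1+pred-updateAt 1≤λv))

  splitWeight-positive : 2 ≤ λ′ v → (∀ i → 1 ≤ λ′ i) → ∀ j → 1 ≤ splitWeight λ′ v j
  splitWeight-positive heavy pos zero = s≤s z≤n
  splitWeight-positive heavy pos (suc j) with j ≟ v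
  ... | yes refl = subst (1 ≤_) (≡.sym (updateAt-updates j λ′)) (ℕₚ.pred-mono-≤ heavy)
  ... | no j≢v   = subst (1 ≤_) (≡.sym (updateAt-minimal j v λ′ j≢v)) (pos j)

chi-splitWeight : ∀ {d} (G : SimpleGraph d) (λ′ : Fin d → ℕ) (v : Fin d) → 1 ≤ λ′ v → ∀ q n →
                  chi G λ′ q n ≡ chi (addIsolatedVertex G) (splitWeight λ′ v) q n
                                 - chi (addPendantVertex G v) (splitWeight λ′ v) q n
chi-splitWeight {d} G λ′ v 1≤λv q n = x≈z//y _ _ _ (≡.sym (begin
  chi (addIsolatedVertex G) μ q n
    ≡⟨ chi-addVertex G (const false) μ q n (λ _ _ → true) avoids-nothing ⟩
  ∑ˡ (λ c → ∑[ i < n ] ([ P c ]· X c i)) cs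
    ≡⟨ ∑ˡ-cong (λ c → ∑-[]·-split (P c) (X c) (c v)) cs ⟩
  ∑ˡ (λ c → [ P c ]· X c (c v) + ∑[ i < n ] ([ not ⌊ c v ≟ i ⌋ ∧ P c ]· X c i)) cs
    ≡⟨ ∑ˡ-distrib (λ c → [ P c ]· X c (c v)) _ cs ⟩
  ∑ˡ (λ c → [ P c ]· X c (c v)) cs
    + ∑ˡ (λ c → ∑[ i < n ] ([ not ⌊ c v ≟ i ⌋ ∧ P c ]· X c i)) cs
    ≡⟨ cong₂ _+_ (trans (∑ˡ-cong same-weight cs) (≡.sym (chi≡∑ˡ G λ′ q n)))
                 (≡.sym (chi-addVertex G (λ u → ⌊ u ≟ v ⌋) μ q n B (avoids-single v))) ⟩
  chi G λ′ q n + chi (addPendantVertex G v) μ q n ∎))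
  where
  open ≡-Reasoning
  μ : Fin (suc d) → ℕ
  μ = splitWeight λ′ v
  cs : List (Fin d → Fin n)
  cs = allMaps d n
  P : (Fin d → Fin n) → Bool
  P = isProper G
  X : (Fin d → Fin n) → Fin n → ℤ
  X c i = q ^ weight μ (consF i c)
  B : (Fin d → Fin n) → Fin n → Bool
  B c i = not ⌊ c v ≟ i ⌋
  same-weight : ∀ c → [ P c ]· X c (c v) ≡ [ P c ]· q ^ weight λ′ c
  same-weight c = cong (λ w → [ P c ]· q ^ w) (weight-splitWeight λ′ v 1≤λv c)

chi𝟏-combination : ∀ {M} → List (ℤ × SimpleGraph M) → ℤ → ℕ → ℤ
chi𝟏-combination kHs q n = ∑ˡ (λ kH → proj₁ kH * chi (proj₂ kH) 𝟏 q n) kHs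

InChi𝟏Span : ℕ → (ℤ → ℕ → ℤ) → Set
InChi𝟏Span M f = Σ (List (ℤ × SimpleGraph M)) λ kHs → ∀ q n → f q n ≡ chi𝟏-combination kHs q n

chi𝟏∈span : ∀ {M} (H : SimpleGraph M) → InChi𝟏Span M (chi H 𝟏)
chi𝟏∈span H = (1ℤ , H) ∷ [] , λ q n → ≡.sym (trans (ℤₚ.+-identityʳ _) (ℤₚ.*-identityˡ _))

inSpan-resp : ∀ {M f g} → (∀ q n → f q n ≡ g q n) → InChi𝟏Span M g → InChi𝟏Span M f
inSpan-resp f≡g (kHs , g≡) = kHs , λ q n → trans (f≡g q n) (g≡ q n)

chi𝟏-combination-neg : ∀ {M} (kHs : List (ℤ × SimpleGraph M)) q n →
                       chi𝟏-combination (map (map₁ (-_)) kHs) q n ≡ - chi𝟏-combination kHs q n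
chi𝟏-combination-neg []              q n = refl
chi𝟏-combination-neg ((k , H) ∷ kHs) q n =
  trans (cong₂ _+_ (≡.sym (ℤₚ.neg-distribˡ-* k (chi H 𝟏 q n))) (chi𝟏-combination-neg kHs q n))
        (≡.sym (ℤₚ.neg-distrib-+ (k * chi H 𝟏 q n) (chi𝟏-combination kHs q n)))

inSpan-sub : ∀ {M f g} → InChi𝟏Span M f → InChi𝟏Span M g → InChi𝟏Span M (λ q n → f q n - g q n)
inSpan-sub {f = f} {g} (kHs , f≡) (lHs , g≡) = kHs ++ map (map₁ (-_)) lHs , λ q n → begin
  f q n - g q n
    ≡⟨ cong₂ _-_ (f≡ q n) (g≡ q n) ⟩
  chi𝟏-combination kHs q n - chi𝟏-combination lHs q n
    ≡⟨ cong (chi𝟏-combination kHs q n +_) (chi𝟏-combination-neg lHs q n) ⟨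
  chi𝟏-combination kHs q n + chi𝟏-combination (map (map₁ (-_)) lHs) q n
    ≡⟨ ∑ˡ-++ (λ kH → proj₁ kH * chi (proj₂ kH) 𝟏 q n) kHs _ ⟨
  chi𝟏-combination (kHs ++ map (map₁ (-_)) lHs) q n ∎
  where open ≡-Reasoning

inSpan⇒family : ∀ {M f} → InChi𝟏Span M f →
                ∃ λ ℓ → Σ (Fin ℓ → SimpleGraph M) λ H → Σ (Fin ℓ → ℤ) λ k →
                  ∀ q n → f q n ≡ sumℤ (λ i → k i * chi (H i) 𝟏 q n)
inSpan⇒family {M} {f} (kHs , f≡) =
  length kHs , proj₂ ∘ lookup kHs , proj₁ ∘ lookup kHs , λ q n → begin
  f q n                                  ≡⟨ f≡ q n ⟩
  ∑ˡ (term q n) kHs                      ≡⟨ cong (∑ˡ (term q n)) (tabulate-lookup kHs) ⟨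
  ∑ˡ (term q n) (tabulate (lookup kHs))  ≡⟨ ∑ˡ-tabulate (term q n) (lookup kHs) ⟩
  sum (term q n ∘ lookup kHs)            ≡⟨ sumℤ≡sum (term q n ∘ lookup kHs) ⟨
  sumℤ (term q n ∘ lookup kHs)           ∎
  where
  open ≡-Reasoning
  term : ℤ → ℕ → ℤ × SimpleGraph M → ℤ
  term q n kH = proj₁ kH * chi (proj₂ kH) 𝟏 q n

n≤sum : ∀ {n} {f : Fin n → ℕ} → (∀ i → 1 ≤ f i) → n ≤ ℕΣ.sum f
n≤sum {zero}  pos = z≤n
n≤sum {suc n} pos = ℕₚ.+-mono-≤ (pos zero) (n≤sum (pos ∘ suc))

sum-ones : ∀ n → ℕΣ.sum {n} (const 1) ≡ n
sum-ones zero    = refl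
sum-ones (suc n) = cong suc (sum-ones n)

chi-inSpan-excess : ∀ {M} t {d} (G : SimpleGraph d) (λ′ : Fin d → ℕ) → (∀ i → 1 ≤ λ′ i) →
                    ℕΣ.sum λ′ ≡ M → t ℕ.+ d ≡ M → InChi𝟏Span M (chi G λ′)
chi-inSpan-excess {M} t {d} G λ′ pos Σλ≡M t+d≡M with any? (λ i → 2 ≤? λ′ i)
... | no ∄heavy =
  inSpan-resp (chi-cong G all-one) (subst (λ m → InChi𝟏Span m (chi G 𝟏)) d≡M (chi𝟏∈span G))
  where
  all-one : ∀ i → λ′ i ≡ 1
  all-one i = ℕₚ.≤-antisym (ℕₚ.≤-pred (ℕₚ.≰⇒> (λ heavy → ∄heavy (i , heavy)))) (pos i)
  d≡M : d ≡ M
  d≡M = trans (≡.sym (sum-ones d)) (trans (ℕΣ.sum-cong-≗ (≡.sym ∘ all-one)) Σλ≡M)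
chi-inSpan-excess zero {d} G λ′ pos Σλ≡M d≡M | yes (v , heavy) =
  ⊥-elim (ℕₚ.n≮n d (subst (suc d ≤_) Σμ≡d (n≤sum (splitWeight-positive λ′ v heavy pos))))
  where
  Σμ≡d : ℕΣ.sum (splitWeight λ′ v) ≡ d
  Σμ≡d = trans (sum-splitWeight λ′ v (ℕₚ.<⇒≤ heavy)) (trans Σλ≡M (≡.sym d≡M))
chi-inSpan-excess (suc t) {d} G λ′ pos Σλ≡M t+d≡M | yes (v , heavy) =
  inSpan-resp (chi-splitWeight G λ′ v (ℕₚ.<⇒≤ heavy))
              (inSpan-sub (recurse (addIsolatedVertex G)) (recurse (addPendantVertex G v)))
  where
  recurse : (H : SimpleGraph (suc d)) → InChi𝟏Span _ (chi H (splitWeight λ′ v))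
  recurse H = chi-inSpan-excess t H (splitWeight λ′ v) (splitWeight-positive λ′ v heavy pos)
                (trans (sum-splitWeight λ′ v (ℕₚ.<⇒≤ heavy)) Σλ≡M) (trans (ℕₚ.+-suc t d) t+d≡M)

chi-inSpan : ∀ {d} (G : SimpleGraph d) (λ′ : Fin d → ℕ) → (∀ i → 1 ≤ λ′ i) →
             InChi𝟏Span (ℕΣ.sum λ′) (chi G λ′)
chi-inSpan {d} G λ′ pos =
  chi-inSpan-excess (ℕΣ.sum λ′ ℕ.∸ d) G λ′ pos refl (ℕₚ.m∸n+n≡m (n≤sum pos))

-- The identity also holds for n = 0.
theorem17 : (d : ℕ) (G : SimpleGraph d) (λ′ : Fin d → ℕ) → (∀ i → 1 ≤ λ′ i) →
    ∃ λ (ℓ : ℕ) → Σ (Fin ℓ → SimpleGraph (sumℕ λ′)) λ H → Σ (Fin ℓ → ℤ) λ k →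
      (n : ℕ) → 1 ≤ n → (q : ℤ) →
        chi G λ′ q n ≡ sumℤ (λ i → k i * chi (H i) 𝟏 q n)
theorem17 d G λ′ pos =
  let span = subst (λ M → InChi𝟏Span M (chi G λ′)) (≡.sym (sumℕ≡sum λ′)) (chi-inSpan G λ′ pos)
      ℓ , H , k , chi≡ = inSpan⇒family span
  in  ℓ , H , k , λ n _ q → chi≡ q n
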